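{- For a word $\sigma=\sigma_1\cdots\sigma_n$ over $\{1,\dots,k\}$, say $\sigma$ avoids $21\text{ - }1$ if there are no indices $i,j$ with $j>i+1$ and $\sigma_i>\sigma_{i+1}=\sigma_j$, and $\sigma$ avoids $21\text{ - }2$ if there are no indices $i,j$ with $j>i+1$ and $\sigma_{i+1}<\sigma_i=\sigma_j$. Let $[k]^n(\tau)$ be the set of words of length $n$ over $\{1,\dots,k\}$ avoiding $\tau$, and $F_\tau(x;k)=\sum_{n\ge0}|[k]^n(\tau)|x^n$. Then the patterns $21\text{ - }1$ and $21\text{ - }2$ are Wilf-equivalent, i.e. $|[k]^n(21\text{ - }1)|=|[k]^n(21\text{ - }2)|$ for all $k,n\ge0$, and for all $k\ge0$, \[ F_{21\text{ - }2}(x;k)=F_{21\text{ - }1}(x;k)=1+\sum_{d=0}^{k-1}\left(x^{d+1}F_{21\text{ - }1}(x;k-d)\sum_{i=d}^{k-1}(1-x)^{i-d}\binom{i}{d}\right). \]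
   Context: The empty word (length $0$) is counted once; $[0]^n$ is empty for $n\ge1$. -}

module Defs where

open import Data.Nat as ℕ using (ℕ; zero; suc; _∸_)
open import Data.Nat.Combinatorics using (_C_)
open import Data.Fin as Fin using (Fin; toℕ)
open import Data.Fin.Properties using (any?)
import Data.Fin.Properties as FinP
import Data.Nat.Properties as ℕP
open import Data.Vec using (Vec; lookup; []; _∷_)
open import Data.List using (List; length; filter; concatMap; map; allFin; [_])
open import Data.Product using (∃; _×_; _,_)
open import Relation.Nullary using (¬_; Dec)
open import Relation.Nullary.Decidable using (_×-dec_; ¬?)
open import Relation.Binary.PropositionalEquality using (_≡_)
open import Data.Integer as ℤ using (ℤ; +_; -_)

-- Words of length n over the alphabet {1,...,k}, encoded as Fin k
-- (letter a ∈ {1..k} is encoded by a-1 : Fin k; order is preserved).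

Word : ℕ → ℕ → Set
Word k n = Vec (Fin k) n

allWords : (k n : ℕ) → List (Word k n)
allWords k zero    = [ [] ]
allWords k (suc n) = concatMap (λ a → map (a ∷_) (allWords k n)) (allFin k)

Occ21-1 : ∀ {k n} → Word k n → Set
Occ21-1 {k} {n} w =
  ∃ λ (i : Fin n) → ∃ λ (i' : Fin n) → ∃ λ (j : Fin n) →
    (toℕ i' ≡ suc (toℕ i)) × (toℕ i' ℕ.< toℕ j) ×
    (lookup w i' Fin.< lookup w i) × (lookup w i' ≡ lookup w j)

Occ21-2 : ∀ {k n} → Word k n → Set
Occ21-2 {k} {n} w =
  ∃ λ (i : Fin n) → ∃ λ (i' : Fin n) → ∃ λ (j : Fin n) →
    (toℕ i' ≡ suc (toℕ i)) × (toℕ i' ℕ.< toℕ j) ×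
    (lookup w i' Fin.< lookup w i) × (lookup w i ≡ lookup w j)

Avoids21-1 : ∀ {k n} → Word k n → Set
Avoids21-1 w = ¬ Occ21-1 w

Avoids21-2 : ∀ {k n} → Word k n → Set
Avoids21-2 w = ¬ Occ21-2 w

occ21-1? : ∀ {k n} (w : Word k n) → Dec (Occ21-1 w)
occ21-1? w = any? λ i → any? λ i' → any? λ j →
  (toℕ i' ℕ.≟ suc (toℕ i)) ×-dec (toℕ i' ℕ.<? toℕ j) ×-dec
  (lookup w i' Fin.<? lookup w i) ×-dec (lookup w i' FinP.≟ lookup w j)

occ21-2? : ∀ {k n} (w : Word k n) → Dec (Occ21-2 w)
occ21-2? w = any? λ i → any? λ i' → any? λ j →
  (toℕ i' ℕ.≟ suc (toℕ i)) ×-dec (toℕ i' ℕ.<? toℕ j) ×-dec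
  (lookup w i' Fin.<? lookup w i) ×-dec (lookup w i FinP.≟ lookup w j)

avoids21-1? : ∀ {k n} (w : Word k n) → Dec (Avoids21-1 w)
avoids21-1? w = ¬? (occ21-1? w)

avoids21-2? : ∀ {k n} (w : Word k n) → Dec (Avoids21-2 w)
avoids21-2? w = ¬? (occ21-2? w)

count21-1 : ℕ → ℕ → ℕ
count21-1 k n = length (filter avoids21-1? (allWords k n))

count21-2 : ℕ → ℕ → ℕ
count21-2 k n = length (filter avoids21-2? (allWords k n))

FPS : Set
FPS = ℕ → ℤ

sumℤ : ℕ → (ℕ → ℤ) → ℤ
sumℤ zero    f = + 0
sumℤ (suc n) f = sumℤ n f ℤ.+ f n

const : ℤ → FPS
const c zero    = c
const c (suc n) = + 0

1ₛ : FPS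
1ₛ = const (+ 1)

X : FPS
X zero          = + 0
X (suc zero)    = + 1
X (suc (suc n)) = + 0

_+ₛ_ : FPS → FPS → FPS
(f +ₛ g) n = f n ℤ.+ g n

_-ₛ_ : FPS → FPS → FPS
(f -ₛ g) n = f n ℤ.- g n

_*ₛ_ : FPS → FPS → FPS
(f *ₛ g) n = sumℤ (suc n) λ m → f m ℤ.* g (n ∸ m)

infixl 6 _+ₛ_ _-ₛ_
infixl 7 _*ₛ_

_^ₛ_ : FPS → ℕ → FPS
f ^ₛ zero  = 1ₛ
f ^ₛ suc m = f *ₛ (f ^ₛ m)

sumₛ : ℕ → (ℕ → FPS) → FPS
sumₛ zero    F = const (+ 0)
sumₛ (suc n) F = sumₛ n F +ₛ F n

-- Σ_{i = a}^{b-1} F i  (empty if b ≤ a)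
sumRangeₛ : ℕ → ℕ → (ℕ → FPS) → FPS
sumRangeₛ a b F = sumₛ (b ∸ a) λ t → F (a ℕ.+ t)

_≈ₛ_ : FPS → FPS → Set
f ≈ₛ g = ∀ n → f n ≡ g n

F21-1 : ℕ → FPS
F21-1 k n = + count21-1 k n

F21-2 : ℕ → FPS
F21-2 k n = + count21-2 k n

RHS : ℕ → FPS
RHS k = 1ₛ +ₛ sumₛ k λ d →
  (X ^ₛ suc d) *ₛ F21-1 (k ∸ d) *ₛ
  sumRangeₛ d k (λ i → ((1ₛ -ₛ X) ^ₛ (i ∸ d)) *ₛ const (+ (i C d)))

module Submission where

-- Read left to right, a word avoids 21-1 (resp. 21-2) iff after each descent σᵢ > σᵢ₊₁ the
-- letter σᵢ₊₁ (resp. σᵢ) never occurs again. Both classes are therefore recognised by an automaton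
-- whose state is the set of still allowed letters together with the last letter read, and in both
-- cases a descent forbids exactly one allowed letter that is not below the new one. Hence the number
-- of accepted continuations depends only on the number m of allowed letters and the number r of them
-- below the last letter, and it obeys the same recursion for both patterns: this is the
-- Wilf-equivalence. For the generating functions G(m,r) of these numbers the recursion reads
-- G(m,r+1) = (1 - x) G(m,r) + x G(m-1,r), which unfolds to
-- G(m,r) = Σ_j C(r,j) (1 - x)^(r-j) x^j F(m-j). Splitting off the first letter,
-- F(k) = 1 + x Σ_{t<k} G(k,t), and exchanging the two summations gives the formula.

open import Defs
import Data.Integer as ℤ
open import Data.Nat using (ℕ)
open import Data.Product using (_×_; _,_)
open import Relation.Binary.PropositionalEquality using (_≡_; cong; sym; trans)

module Enumeration where

  import Data.Nat.Properties as ℕP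
  open import Algebra.Properties.CommutativeSemigroup ℕP.+-commutativeSemigroup using (xy∙z≈xz∙y)
  open import Data.Bool using (Bool; true; false; if_then_else_; _∧_; not; T)
  open import Data.Bool.Properties using (T?; T-≡; T-∧; ∧-identityʳ; ∧-zeroʳ)
  open import Data.Fin as Fin using (Fin; toℕ)
  import Data.Fin.Properties as FinP
  open import Data.List using (List; []; _∷_; _++_; length; filter; concatMap; map; allFin; tabulate)
  open import Data.List.Properties using (length-++; filter-++; filter-none; map-tabulate)
  import Data.List.Relation.Unary.All as ListAll
  open import Data.List.Relation.Unary.All.Properties using (map⁺)
  open import Data.Nat as ℕ using (zero; suc; _+_; _∸_; _≤_; _<_; _≤′_; _<?_; _≟_; _≡ᵇ_; z≤n; s≤s; ≤′-refl; ≤′-step)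
  open import Data.Nat.ListAction using (sum)
  open import Data.Empty using (⊥-elim)
  open import Data.Product using (∃; proj₁; proj₂)
  open import Data.Sum using (inj₁; inj₂)
  open import Data.Unit using (⊤; tt)
  open import Data.Vec using ([]; _∷_; lookup)
  open import Data.Vec.Relation.Unary.All as All using (All; []; _∷_)
  open import Data.Vec.Relation.Unary.All.Properties using (lookup⁺; lookup⁻)
  open import Function using (id; _∘_; _⇔_; mk⇔; Equivalence)
  open import Level using (0ℓ)
  open import Relation.Nullary using (¬_; Dec; yes; no; does; contradiction)
  open import Relation.Nullary.Decidable using (_×-dec_; dec-true; dec-false; does-⇔)
  open import Relation.Unary using (Pred; Decidable)
  open import Relation.Binary.PropositionalEquality using (_≢_; refl; cong₂; subst; module ≡-Reasoning)

  sumℕ : ℕ → (ℕ → ℕ) → ℕ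
  sumℕ zero    f = 0
  sumℕ (suc n) f = sumℕ n f + f n

  sumℕ-cong : ∀ n {f g : ℕ → ℕ} → (∀ t → t < n → f t ≡ g t) → sumℕ n f ≡ sumℕ n g
  sumℕ-cong zero    eq = refl
  sumℕ-cong (suc n) eq = cong₂ _+_ (sumℕ-cong n (λ t t<n → eq t (ℕP.m<n⇒m<1+n t<n))) (eq n ℕP.≤-refl)

  sumℕ-first : ∀ n (f : ℕ → ℕ) → sumℕ (suc n) f ≡ f 0 + sumℕ n (f ∘ suc)
  sumℕ-first zero    f = ℕP.+-comm 0 (f 0)
  sumℕ-first (suc n) f = trans (cong (_+ f (suc n)) (sumℕ-first n f)) (ℕP.+-assoc (f 0) _ _)

  sumℕ-update : ∀ m r {f g : ℕ → ℕ} → r < m → (∀ t → t ≢ r → f t ≡ g t) →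
                sumℕ m f + g r ≡ sumℕ m g + f r
  sumℕ-update (suc m) r {f} {g} r<1+m f≗g with ℕP.m≤n⇒m<n∨m≡n (ℕP.≤-pred r<1+m)
  ... | inj₂ refl = begin
    sumℕ r f + f r + g r ≡⟨ xy∙z≈xz∙y (sumℕ r f) (f r) (g r) ⟩
    sumℕ r f + g r + f r ≡⟨ cong (λ s → s + g r + f r) (sumℕ-cong r (λ t t<r → f≗g t (ℕP.<⇒≢ t<r))) ⟩
    sumℕ r g + g r + f r ∎
    where open ≡-Reasoning
  ... | inj₁ r<m = begin
    sumℕ m f + f m + g r ≡⟨ xy∙z≈xz∙y (sumℕ m f) (f m) (g r) ⟩
    sumℕ m f + g r + f m ≡⟨ cong₂ _+_ (sumℕ-update m r r<m f≗g) (f≗g m (ℕP.>⇒≢ r<m)) ⟩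
    sumℕ m g + f r + g m ≡⟨ xy∙z≈xz∙y (sumℕ m g) (f r) (g m) ⟩
    sumℕ m g + g m + f r ∎
    where open ≡-Reasoning

  LetterSet : Set
  LetterSet = ℕ → Bool

  _─_ : LetterSet → ℕ → LetterSet
  (A ─ x) y = A y ∧ not (y ≡ᵇ x)

  rank : LetterSet → ℕ → ℕ
  rank A zero    = 0
  rank A (suc N) = if A N then suc (rank A N) else rank A N

  rank-suc : ∀ A N → rank A N ≤ rank A (suc N)
  rank-suc A N with A N
  ... | true  = ℕP.n≤1+n (rank A N)
  ... | false = ℕP.≤-refl

  rank-mono : ∀ A {N M} → N ≤ M → rank A N ≤ rank A M
  rank-mono A N≤M = go (ℕP.≤⇒≤′ N≤M)
    where
    go : ∀ {N M} → N ≤′ M → rank A N ≤ rank A M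
    go ≤′-refl          = ℕP.≤-refl
    go (≤′-step {M} N≤M) = ℕP.≤-trans (go N≤M) (rank-suc A M)

  rank-suc-∈ : ∀ A {a} → T (A a) → rank A (suc a) ≡ suc (rank A a)
  rank-suc-∈ A {a} a∈A = cong (λ b → if b then suc (rank A a) else rank A a) (Equivalence.to T-≡ a∈A)

  rank-< : ∀ A {a N} → T (A a) → a < N → rank A a < rank A N
  rank-< A a∈A a<N = ℕP.≤-trans (ℕP.≤-reflexive (sym (rank-suc-∈ A a∈A))) (rank-mono A a<N)

  rank-<-⇔ : ∀ A {a ℓ} → T (A a) → a < ℓ ⇔ rank A a < rank A ℓ
  rank-<-⇔ A a∈A = mk⇔ (rank-< A a∈A) (λ r<r → ℕP.≰⇒> (λ ℓ≤a → ℕP.<⇒≱ r<r (rank-mono A ℓ≤a)))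

  rank-─-≤ : ∀ A {x} N → N ≤ x → rank (A ─ x) N ≡ rank A N
  rank-─-≤ A zero    _   = refl
  rank-─-≤ A {x} (suc N) N<x
    rewrite dec-false (N ≟ x) (ℕP.<⇒≢ N<x) | ∧-identityʳ (A N) | rank-─-≤ A N (ℕP.<⇒≤ N<x) = refl

  rank-─ : ∀ A {x} N → T (A x) → x < N → suc (rank (A ─ x) N) ≡ rank A N
  rank-─ A {x} (suc N) x∈A x<1+N with ℕP.m≤n⇒m<n∨m≡n (ℕP.≤-pred x<1+N)
  ... | inj₂ refl rewrite dec-true (x ≟ x) refl | ∧-zeroʳ (A x) =
    trans (cong suc (rank-─-≤ A x ℕP.≤-refl)) (sym (rank-suc-∈ A x∈A))
  rank-─ A {x} (suc N) x∈A x<1+N | inj₁ x<N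
    rewrite dec-false (N ≟ x) (ℕP.>⇒≢ x<N) | ∧-identityʳ (A N) | sym (rank-─ A N x∈A x<N) with A N
  ... | true  = refl
  ... | false = refl

  sumℕ-members : ∀ A N (H : ℕ → ℕ) →
                 sumℕ N (λ x → if A x then H (rank A x) else 0) ≡ sumℕ (rank A N) H
  sumℕ-members A zero    H = refl
  sumℕ-members A (suc N) H with A N
  ... | true  = cong (_+ H (rank A N)) (sumℕ-members A N H)
  ... | false = trans (ℕP.+-identityʳ _) (sumℕ-members A N H)

  -- Allowed letters left after reading rank s behind rank r: a descent forbids one more.
  sizeAfter : ℕ → ℕ → ℕ → ℕ
  sizeAfter m r s = if does (s <? r) then m ∸ 1 else m

  -- Continuations of length n from a state with m allowed letters, r of them below the last letter.
  accepted : ℕ → ℕ → ℕ → ℕ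
  accepted m r zero    = 1
  accepted m r (suc n) = sumℕ m λ s → accepted (sizeAfter m r s) s n

  accepted-recurrence : ∀ m r n → r < m →
    accepted m (suc r) (suc n) + accepted m r n ≡ accepted m r (suc n) + accepted (m ∸ 1) r n
  accepted-recurrence m r n r<m = begin
    accepted m (suc r) (suc n) + accepted m r n
      ≡⟨ cong (λ b → accepted m (suc r) (suc n) + accepted (if b then m ∸ 1 else m) r n)
              (sym (dec-false (r <? r) (ℕP.<-irrefl refl))) ⟩
    sumℕ m (summand (suc r)) + summand r r
      ≡⟨ sumℕ-update m r r<m summands-agree ⟩
    sumℕ m (summand r) + summand (suc r) r
      ≡⟨ cong (λ b → accepted m r (suc n) + accepted (if b then m ∸ 1 else m) r n)
              (dec-true (r <? suc r) ℕP.≤-refl) ⟩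
    accepted m r (suc n) + accepted (m ∸ 1) r n ∎
    where
    open ≡-Reasoning
    summand : ℕ → ℕ → ℕ
    summand r′ s = accepted (sizeAfter m r′ s) s n
    summands-agree : ∀ s → s ≢ r → summand (suc r) s ≡ summand r s
    summands-agree s s≢r = cong (λ b → accepted (if b then m ∸ 1 else m) s n)
      (does-⇔ (mk⇔ (λ s<1+r → ℕP.≤∧≢⇒< (ℕP.≤-pred s<1+r) s≢r) ℕP.m<n⇒m<1+n) (s <? suc r) (s <? r))

  module _ {A B : Set} {P : Pred B 0ℓ} (P? : Decidable P) where

    length-filter-concatMap : ∀ (f : A → List B) xs →
      length (filter P? (concatMap f xs)) ≡ sum (map (length ∘ filter P? ∘ f) xs)
    length-filter-concatMap f []       = refl
    length-filter-concatMap f (x ∷ xs) = begin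
      length (filter P? (f x ++ concatMap f xs))
        ≡⟨ cong length (filter-++ P? (f x) (concatMap f xs)) ⟩
      length (filter P? (f x) ++ filter P? (concatMap f xs))
        ≡⟨ length-++ (filter P? (f x)) ⟩
      length (filter P? (f x)) + length (filter P? (concatMap f xs))
        ≡⟨ cong (length (filter P? (f x)) +_) (length-filter-concatMap f xs) ⟩
      length (filter P? (f x)) + sum (map (length ∘ filter P? ∘ f) xs) ∎
      where open ≡-Reasoning

    length-filter-map : ∀ {Q : Pred A 0ℓ} (Q? : Decidable Q) (f : A → B) → (∀ x → P (f x) ⇔ Q x) →
                        ∀ xs → length (filter P? (map f xs)) ≡ length (filter Q? xs)
    length-filter-map Q? f P∘f⇔Q []       = refl
    length-filter-map Q? f P∘f⇔Q (x ∷ xs) with P? (f x) | Q? x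
    ... | yes _  | yes _ = cong suc (length-filter-map Q? f P∘f⇔Q xs)
    ... | no _   | no _  = length-filter-map Q? f P∘f⇔Q xs
    ... | yes p  | no ¬q = contradiction (Equivalence.to (P∘f⇔Q x) p) ¬q
    ... | no ¬p  | yes q = contradiction (Equivalence.from (P∘f⇔Q x) q) ¬p

  sum-tabulate : ∀ k (h : Fin k → ℕ) (E : ℕ → ℕ) → (∀ a → h a ≡ E (toℕ a)) →
                 sum (tabulate h) ≡ sumℕ k E
  sum-tabulate zero    h E h≗E = refl
  sum-tabulate (suc k) h E h≗E =
    trans (cong₂ _+_ (h≗E Fin.zero) (sum-tabulate k (h ∘ Fin.suc) (E ∘ suc) (h≗E ∘ Fin.suc)))
          (sym (sumℕ-first k E))

  count-by-first-letter : ∀ k n {P : Pred (Word k (suc n)) 0ℓ} (P? : Decidable P) (E : ℕ → ℕ) →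
    (∀ a → length (filter P? (map (a ∷_) (allWords k n))) ≡ E (toℕ a)) →
    length (filter P? (allWords k (suc n))) ≡ sumℕ k E
  count-by-first-letter k n P? E byLetter = begin
    length (filter P? (concatMap (λ a → map (a ∷_) (allWords k n)) (allFin k)))
      ≡⟨ length-filter-concatMap P? (λ a → map (a ∷_) (allWords k n)) (allFin k) ⟩
    sum (map withFirst (allFin k))
      ≡⟨ cong sum (map-tabulate {n = k} id withFirst) ⟩
    sum (tabulate withFirst)
      ≡⟨ sum-tabulate k withFirst E byLetter ⟩
    sumℕ k E ∎
    where
    open ≡-Reasoning
    withFirst : Fin k → ℕ
    withFirst a = length (filter P? (map (a ∷_) (allWords k n)))

  full : LetterSet
  full _ = true

  rank-full : ∀ N → rank full N ≡ N
  rank-full zero    = refl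
  rank-full (suc N) = cong suc (rank-full N)

  -- After a descent ℓ > b, the letter repeated ℓ b may not occur again:
  -- b for 21-1 and ℓ for 21-2.
  module DescentPattern (repeated : ∀ {k} → Fin k → Fin k → Fin k) where

    Occurrence : ∀ {k n} → Word k n → Set
    Occurrence {k} {n} w =
      ∃ λ (i : Fin n) → ∃ λ (i' : Fin n) → ∃ λ (j : Fin n) →
        (toℕ i' ≡ suc (toℕ i)) × (toℕ i' < toℕ j) ×
        (lookup w i' Fin.< lookup w i) × (repeated (lookup w i) (lookup w i') ≡ lookup w j)

    AvoidsFrom : ∀ {k n} → Fin k → Word k n → Set
    AvoidsFrom ℓ []      = ⊤
    AvoidsFrom ℓ (b ∷ w) = (b Fin.< ℓ → All (repeated ℓ b ≢_) w) × AvoidsFrom b w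

    occurrence-∷ : ∀ {k n} (a : Fin k) {w : Word k n} → Occurrence w → Occurrence (a ∷ w)
    occurrence-∷ a (i , i' , j , i'≡1+i , i'<j , descent , repeat) =
      Fin.suc i , Fin.suc i' , Fin.suc j , cong suc i'≡1+i , s≤s i'<j , descent , repeat

    avoidsFrom⇒¬occurrence : ∀ {k n} (ℓ : Fin k) (w : Word k n) → AvoidsFrom ℓ w → ¬ Occurrence (ℓ ∷ w)
    avoidsFrom⇒¬occurrence ℓ (b ∷ w) (noRepeat , _)
      (Fin.zero , Fin.suc Fin.zero , Fin.suc (Fin.suc p) , _ , _ , descent , repeat) =
      lookup⁺ (noRepeat descent) p repeat
    avoidsFrom⇒¬occurrence ℓ (b ∷ w) _ (Fin.zero , Fin.suc Fin.zero , Fin.suc Fin.zero , _ , s≤s () , _)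
    avoidsFrom⇒¬occurrence ℓ w _ (Fin.zero , Fin.suc Fin.zero , Fin.zero , _ , () , _)
    avoidsFrom⇒¬occurrence ℓ w _ (Fin.zero , Fin.suc (Fin.suc _) , _ , () , _)
    avoidsFrom⇒¬occurrence ℓ w _ (Fin.zero , Fin.zero , _ , () , _)
    avoidsFrom⇒¬occurrence ℓ w _ (Fin.suc _ , Fin.zero , _ , () , _)
    avoidsFrom⇒¬occurrence ℓ w _ (Fin.suc _ , Fin.suc _ , Fin.zero , _ , () , _)
    avoidsFrom⇒¬occurrence ℓ (b ∷ w) (_ , avoids)
      (Fin.suc i , Fin.suc i' , Fin.suc j , i'≡1+i , s≤s i'<j , descent , repeat) =
      avoidsFrom⇒¬occurrence b w avoids (i , i' , j , ℕP.suc-injective i'≡1+i , i'<j , descent , repeat)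

    ¬occurrence⇒avoidsFrom : ∀ {k n} (ℓ : Fin k) (w : Word k n) → ¬ Occurrence (ℓ ∷ w) → AvoidsFrom ℓ w
    ¬occurrence⇒avoidsFrom ℓ []      _    = tt
    ¬occurrence⇒avoidsFrom ℓ (b ∷ w) ¬occ =
      (λ descent → lookup⁻ λ p repeat →
        ¬occ (Fin.zero , Fin.suc Fin.zero , Fin.suc (Fin.suc p) , refl , s≤s (s≤s z≤n) , descent , repeat)) ,
      ¬occurrence⇒avoidsFrom b w (¬occ ∘ occurrence-∷ ℓ)

    Allowed : ∀ {k} → LetterSet → Fin k → Set
    Allowed A b = T (A (toℕ b))

    after : ∀ {k} → LetterSet → Fin k → Fin k → LetterSet
    after A ℓ b = if does (toℕ b <? toℕ ℓ) then A ─ toℕ (repeated ℓ b) else A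

    Accepts : ∀ {k n} → LetterSet → Fin k → Word k n → Set
    Accepts A ℓ []      = ⊤
    Accepts A ℓ (b ∷ w) = Allowed A b × Accepts (after A ℓ b) b w

    accepts? : ∀ {k n} A (ℓ : Fin k) (w : Word k n) → Dec (Accepts A ℓ w)
    accepts? A ℓ []      = yes tt
    accepts? A ℓ (b ∷ w) = T? (A (toℕ b)) ×-dec accepts? (after A ℓ b) b w

    allowed-─ : ∀ {k} A (x c : Fin k) → Allowed (A ─ toℕ x) c ⇔ (Allowed A c × x ≢ c)
    allowed-─ A x c with toℕ c ≡ᵇ toℕ x in c≡ᵇx
    ... | true  = mk⇔ (λ c∈A─x → ⊥-elim (proj₂ (Equivalence.to (T-∧ {A (toℕ c)}) c∈A─x)))
                      (λ (_ , x≢c) → contradiction (FinP.toℕ-injective (sym c≡x)) x≢c)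
      where c≡x = ℕP.≡ᵇ⇒≡ (toℕ c) (toℕ x) (subst T (sym c≡ᵇx) tt)
    ... | false = mk⇔ (λ c∈A─x → proj₁ (Equivalence.to T-∧ c∈A─x) , x≢c)
                      (λ (c∈A , _) → Equivalence.from T-∧ (c∈A , tt))
      where x≢c = λ x≡c → subst T c≡ᵇx (ℕP.≡⇒≡ᵇ _ _ (cong toℕ (sym x≡c)))

    all-allowed-after : ∀ {k n} A (ℓ b : Fin k) (w : Word k n) →
      All (Allowed (after A ℓ b)) w ⇔ (All (Allowed A) w × (b Fin.< ℓ → All (repeated ℓ b ≢_) w))
    all-allowed-after A ℓ b w with toℕ b <? toℕ ℓ
    ... | yes b<ℓ rewrite dec-true (toℕ b <? toℕ ℓ) b<ℓ = mk⇔
      (λ all → let (all′ , noRepeat) = All.unzip (All.map (Equivalence.to (allowed-─ A _ _)) all)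
               in all′ , λ _ → noRepeat)
      (λ (all , noRepeat) → All.map (Equivalence.from (allowed-─ A _ _)) (All.zip (all , noRepeat b<ℓ)))
    ... | no  b≮ℓ rewrite dec-false (toℕ b <? toℕ ℓ) b≮ℓ = mk⇔
      (λ all → all , λ b<ℓ → contradiction b<ℓ b≮ℓ)
      proj₁

    accepts⇔ : ∀ {k n} A (ℓ : Fin k) (w : Word k n) → Accepts A ℓ w ⇔ (All (Allowed A) w × AvoidsFrom ℓ w)
    accepts⇔ A ℓ []      = mk⇔ (λ _ → [] , tt) (λ _ → tt)
    accepts⇔ A ℓ (b ∷ w) = mk⇔ to from
      where
      to : Accepts A ℓ (b ∷ w) → All (Allowed A) (b ∷ w) × AvoidsFrom ℓ (b ∷ w)
      to (b∈A , accepts) =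
        let (allAfter , avoids) = Equivalence.to (accepts⇔ (after A ℓ b) b w) accepts
            (all , noRepeat)    = Equivalence.to (all-allowed-after A ℓ b w) allAfter
        in b∈A ∷ all , noRepeat , avoids
      from : All (Allowed A) (b ∷ w) × AvoidsFrom ℓ (b ∷ w) → Accepts A ℓ (b ∷ w)
      from (b∈A ∷ all , noRepeat , avoids) =
        b∈A , Equivalence.from (accepts⇔ (after A ℓ b) b w)
                (Equivalence.from (all-allowed-after A ℓ b w) (all , noRepeat) , avoids)

    ¬occurrence⇔accepts : ∀ {k n} (ℓ : Fin k) (w : Word k n) → (¬ Occurrence (ℓ ∷ w)) ⇔ Accepts full ℓ w
    ¬occurrence⇔accepts ℓ w = mk⇔
      (λ ¬occ → Equivalence.from (accepts⇔ full ℓ w) (All.universal _ w , ¬occurrence⇒avoidsFrom ℓ w ¬occ))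
      (avoidsFrom⇒¬occurrence ℓ w ∘ proj₂ ∘ Equivalence.to (accepts⇔ full ℓ w))

    -- Holds in every reachable state; it makes each descent remove exactly one allowed letter.
    RepeatAllowed : ∀ {k} → LetterSet → Fin k → Set
    RepeatAllowed A ℓ = ∀ {b} → b Fin.< ℓ → Allowed A b → Allowed A (repeated ℓ b)

    allowed-after : ∀ {k} A (ℓ b : Fin k) → Allowed A b → (b Fin.< ℓ → repeated ℓ b ≢ b) →
                    Allowed (after A ℓ b) b
    allowed-after A ℓ b b∈A fresh with toℕ b <? toℕ ℓ
    ... | yes b<ℓ rewrite dec-true (toℕ b <? toℕ ℓ) b<ℓ = Equivalence.from (allowed-─ A _ b) (b∈A , fresh b<ℓ)
    ... | no  b≮ℓ rewrite dec-false (toℕ b <? toℕ ℓ) b≮ℓ = b∈A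

    module Counting
      (repeated-≥ : ∀ {k} {ℓ b : Fin k} → b Fin.< ℓ → b Fin.≤ repeated ℓ b)
      (repeatAllowed-after : ∀ {k} {A} {ℓ b : Fin k} → Allowed A b → RepeatAllowed (after A ℓ b) b)
      where

      accepting : ∀ {k} → LetterSet → Fin k → ℕ → ℕ
      accepting {k} A ℓ n = length (filter (accepts? A ℓ) (allWords k n))

      rank-after-below : ∀ {k} A (ℓ b : Fin k) → rank (after A ℓ b) (toℕ b) ≡ rank A (toℕ b)
      rank-after-below A ℓ b with toℕ b <? toℕ ℓ
      ... | yes b<ℓ rewrite dec-true (toℕ b <? toℕ ℓ) b<ℓ = rank-─-≤ A (toℕ b) (repeated-≥ b<ℓ)
      ... | no  b≮ℓ rewrite dec-false (toℕ b <? toℕ ℓ) b≮ℓ = refl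

      rank-after-total : ∀ {k} A (ℓ b : Fin k) → Allowed A b → RepeatAllowed A ℓ →
                         rank (after A ℓ b) k ≡ sizeAfter (rank A k) (toℕ ℓ) (toℕ b)
      rank-after-total {k} A ℓ b b∈A repeatAllowed with toℕ b <? toℕ ℓ
      ... | yes b<ℓ rewrite dec-true (toℕ b <? toℕ ℓ) b<ℓ =
        cong ℕ.pred (rank-─ A k (repeatAllowed b<ℓ b∈A) (FinP.toℕ<n (repeated ℓ b)))
      ... | no  b≮ℓ rewrite dec-false (toℕ b <? toℕ ℓ) b≮ℓ = refl

      sizeAfter-rank : ∀ {k} A (ℓ b : Fin k) → Allowed A b →
        sizeAfter (rank A k) (toℕ ℓ) (toℕ b) ≡ sizeAfter (rank A k) (rank A (toℕ ℓ)) (rank A (toℕ b))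
      sizeAfter-rank {k} A ℓ b b∈A = cong (if_then rank A k ∸ 1 else rank A k)
        (does-⇔ (rank-<-⇔ A b∈A) (toℕ b <? toℕ ℓ) (rank A (toℕ b) <? rank A (toℕ ℓ)))

      accepting≡accepted : ∀ {k} n A (ℓ : Fin k) → RepeatAllowed A ℓ →
                           accepting A ℓ n ≡ accepted (rank A k) (rank A (toℕ ℓ)) n
      accepting≡accepted         zero    A ℓ _             = refl
      accepting≡accepted {k} (suc n) A ℓ repeatAllowed = begin
        accepting A ℓ (suc n)
          ≡⟨ count-by-first-letter k n (accepts? A ℓ) _ byLetter ⟩
        sumℕ k (λ x → if A x then H (rank A x) else 0)
          ≡⟨ sumℕ-members A k H ⟩
        sumℕ (rank A k) H ∎
        where
        open ≡-Reasoning
        H : ℕ → ℕ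
        H s = accepted (sizeAfter (rank A k) (rank A (toℕ ℓ)) s) s n
        byLetter : ∀ b → length (filter (accepts? A ℓ) (map (b ∷_) (allWords k n))) ≡
                         (if A (toℕ b) then H (rank A (toℕ b)) else 0)
        byLetter b with A (toℕ b) in b∈?A
        ... | false = cong length (filter-none (accepts? A ℓ)
                        (map⁺ (ListAll.universal (λ _ (b∈A , _) → subst T b∈?A b∈A) (allWords k n))))
        ... | true  = begin
          length (filter (accepts? A ℓ) (map (b ∷_) (allWords k n)))
            ≡⟨ length-filter-map (accepts? A ℓ) (accepts? (after A ℓ b) b) (b ∷_)
                 (λ _ → mk⇔ proj₂ (b∈A ,_)) (allWords k n) ⟩
          accepting (after A ℓ b) b n
            ≡⟨ accepting≡accepted n (after A ℓ b) b (repeatAllowed-after {A = A} {ℓ} b∈A) ⟩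
          accepted (rank (after A ℓ b) k) (rank (after A ℓ b) (toℕ b)) n
            ≡⟨ cong₂ (λ m r → accepted m r n)
                 (trans (rank-after-total A ℓ b b∈A repeatAllowed) (sizeAfter-rank A ℓ b b∈A))
                 (rank-after-below A ℓ b) ⟩
          H (rank A (toℕ b)) ∎
          where b∈A = subst T (sym b∈?A) tt

      -- Nothing lies below rank 0, so accepted k 0 also counts the words without a previous letter.
      avoiding≡accepted : ∀ k n (avoids? : (w : Word k n) → Dec (¬ Occurrence w)) →
                          length (filter avoids? (allWords k n)) ≡ accepted k 0 n
      avoiding≡accepted k zero    avoids? with avoids? []
      ... | yes _       = refl
      ... | no  ¬avoids = contradiction (λ ()) ¬avoids
      avoiding≡accepted k (suc n) avoids? =
        count-by-first-letter k n avoids? (λ s → accepted k s n) λ a → begin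
          length (filter avoids? (map (a ∷_) (allWords k n)))
            ≡⟨ length-filter-map avoids? (accepts? full a) (a ∷_) (¬occurrence⇔accepts a) (allWords k n) ⟩
          accepting full a n
            ≡⟨ accepting≡accepted n full a (λ _ _ → tt) ⟩
          accepted (rank full k) (rank full (toℕ a)) n
            ≡⟨ cong₂ (λ m r → accepted m r n) (rank-full k) (rank-full (toℕ a)) ⟩
          accepted k (toℕ a) n ∎
        where open ≡-Reasoning

  -- Occ21-1 and Occ21-2 are definitionally the occurrences of these two instances.
  module Pattern21-1 = DescentPattern (λ _ b → b)
  module Pattern21-2 = DescentPattern (λ a _ → a)

  count21-1≡accepted : ∀ k n → count21-1 k n ≡ accepted k 0 n
  count21-1≡accepted k n = avoiding≡accepted k n avoids21-1?
    where open Pattern21-1.Counting (λ _ → ℕP.≤-refl) (λ _ _ → id)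

  count21-2≡accepted : ∀ k n → count21-2 k n ≡ accepted k 0 n
  count21-2≡accepted k n = avoiding≡accepted k n avoids21-2?
    where
    open Pattern21-2
    open Counting ℕP.<⇒≤ (λ {_} {A} {ℓ} {b} b∈A _ _ → allowed-after A ℓ b b∈A (λ b<ℓ → ℕP.>⇒≢ b<ℓ ∘ cong toℕ))

module GeneratingFunction where

  open Enumeration using (sumℕ; accepted; accepted-recurrence; count21-1≡accepted)
  open import Data.Integer as ℤ using (ℤ; +_; 0ℤ; _+_; _-_; _*_)
  import Data.Integer.Properties as ℤP
  open import Data.Integer.Tactic.RingSolver using (solve-∀)
  open import Data.Nat as ℕ using (zero; suc; _∸_; _≤_; _<_)
  import Data.Nat.Properties as ℕP
  open import Data.Nat.Combinatorics using (_C_; nCk+nC[k+1]≡[n+1]C[k+1]; k>n⇒nCk≡0)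
  open import Function using (_∘_)
  open import Relation.Binary.Bundles using (Setoid)
  open import Relation.Binary.PropositionalEquality using (refl; cong₂; _→-setoid_; module ≡-Reasoning)
  import Relation.Binary.Reasoning.Setoid as SetoidReasoning

  *-distribˡ-- : ∀ a b c → a * (b - c) ≡ a * b - a * c
  *-distribˡ-- = solve-∀

  sumℤ-cong : ∀ n {f g : ℕ → ℤ} → (∀ t → t < n → f t ≡ g t) → sumℤ n f ≡ sumℤ n g
  sumℤ-cong zero    eq = refl
  sumℤ-cong (suc n) eq = cong₂ _+_ (sumℤ-cong n (λ t t<n → eq t (ℕP.m<n⇒m<1+n t<n))) (eq n ℕP.≤-refl)

  sumℤ-first : ∀ n (f : ℕ → ℤ) → sumℤ (suc n) f ≡ f 0 + sumℤ n (f ∘ suc)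
  sumℤ-first zero    f = trans (ℤP.+-identityˡ (f 0)) (sym (ℤP.+-identityʳ (f 0)))
  sumℤ-first (suc n) f = trans (cong (_+ f (suc n)) (sumℤ-first n f)) (ℤP.+-assoc (f 0) _ _)

  sumℤ-+ : ∀ n (f g : ℕ → ℤ) → sumℤ n (λ t → f t + g t) ≡ sumℤ n f + sumℤ n g
  sumℤ-+ zero    f g = refl
  sumℤ-+ (suc n) f g =
    trans (cong (_+ (f n + g n)) (sumℤ-+ n f g)) (interchange (sumℤ n f) (sumℤ n g) (f n) (g n))
    where
    interchange : ∀ a b c d → a + b + (c + d) ≡ a + c + (b + d)
    interchange = solve-∀

  sumℤ-- : ∀ n (f g : ℕ → ℤ) → sumℤ n (λ t → f t - g t) ≡ sumℤ n f - sumℤ n g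
  sumℤ-- zero    f g = refl
  sumℤ-- (suc n) f g =
    trans (cong (_+ (f n - g n)) (sumℤ-- n f g)) (interchange (sumℤ n f) (sumℤ n g) (f n) (g n))
    where
    interchange : ∀ a b c d → a - b + (c - d) ≡ a + c - (b + d)
    interchange = solve-∀

  sumℤ-*ˡ : ∀ n c (f : ℕ → ℤ) → sumℤ n (λ t → c * f t) ≡ c * sumℤ n f
  sumℤ-*ˡ zero    c f = sym (ℤP.*-zeroʳ c)
  sumℤ-*ˡ (suc n) c f =
    trans (cong (_+ c * f n) (sumℤ-*ˡ n c f)) (sym (ℤP.*-distribˡ-+ c (sumℤ n f) (f n)))

  sumℤ-zero : ∀ n → sumℤ n (λ _ → 0ℤ) ≡ 0ℤ
  sumℤ-zero zero    = refl
  sumℤ-zero (suc n) = cong (_+ 0ℤ) (sumℤ-zero n)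

  sumℤ-swap : ∀ m n (f : ℕ → ℕ → ℤ) →
              sumℤ m (λ i → sumℤ n (f i)) ≡ sumℤ n (λ j → sumℤ m (λ i → f i j))
  sumℤ-swap zero    n f = sym (sumℤ-zero n)
  sumℤ-swap (suc m) n f =
    trans (cong (_+ sumℤ n (f m)) (sumℤ-swap m n f)) (sym (sumℤ-+ n _ (f m)))

  sumℤ-triangle : ∀ k (T : ℕ → ℕ → ℤ) →
    sumℤ k (λ t → sumℤ (suc t) (T t)) ≡ sumℤ k (λ d → sumℤ (k ∸ d) (λ u → T (d ℕ.+ u) d))
  sumℤ-triangle zero    T = refl
  sumℤ-triangle (suc k) T = begin
    sumℤ k (λ t → sumℤ (suc t) (T t)) + sumℤ (suc k) (T k)
      ≡⟨ cong (_+ sumℤ (suc k) (T k)) (sumℤ-triangle k T) ⟩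
    sumℤ k (column k) + (sumℤ k (T k) + T k k)
      ≡⟨ ℤP.+-assoc (sumℤ k (column k)) _ _ ⟨
    sumℤ k (column k) + sumℤ k (T k) + T k k
      ≡⟨ cong₂ _+_ (sumℤ-+ k (column k) (T k)) corner ⟨
    sumℤ k (λ d → column k d + T k d) + column (suc k) k
      ≡⟨ cong (_+ column (suc k) k) (sumℤ-cong k λ d d<k → extend d (ℕP.<⇒≤ d<k)) ⟨
    sumℤ k (column (suc k)) + column (suc k) k ∎
    where
    open ≡-Reasoning
    column : ℕ → ℕ → ℤ
    column k′ d = sumℤ (k′ ∸ d) (λ u → T (d ℕ.+ u) d)
    extend : ∀ d → d ≤ k → column (suc k) d ≡ column k d + T k d
    extend d d≤k rewrite ℕP.+-∸-assoc 1 d≤k | ℕP.m+[n∸m]≡n d≤k = refl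
    corner : column (suc k) k ≡ T k k
    corner rewrite ℕP.+-∸-assoc 1 (ℕP.≤-refl {k}) | ℕP.n∸n≡0 k | ℕP.+-identityʳ k = ℤP.+-identityˡ (T k k)

  +-sumℕ : ∀ n (f : ℕ → ℕ) → + sumℕ n f ≡ sumℤ n (+_ ∘ f)
  +-sumℕ zero    f = refl
  +-sumℕ (suc n) f = trans (ℤP.pos-+ (sumℕ n f) (f n)) (cong (_+ + f n) (+-sumℕ n f))

  FPS-setoid : Setoid _ _
  FPS-setoid = ℕ →-setoid ℤ

  open Setoid FPS-setoid using () renaming (refl to ≈ₛ-refl; trans to ≈ₛ-trans)

  shift : FPS → FPS
  shift f zero    = 0ℤ
  shift f (suc n) = f n

  Δ : FPS → FPS
  Δ f = f -ₛ shift f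

  infixl 7 _·ₛ_
  _·ₛ_ : ℤ → FPS → FPS
  (c ·ₛ f) n = c * f n

  infixr 8 _^[_]
  _^[_] : {A : Set} → (A → A) → ℕ → A → A
  (op ^[ zero  ]) a = a
  (op ^[ suc j ]) a = op ((op ^[ j ]) a)

  Congruent : (FPS → FPS) → Set
  Congruent op = ∀ {f g} → f ≈ₛ g → op f ≈ₛ op g

  ^[]-cong : ∀ {op} → Congruent op → ∀ j → Congruent (op ^[ j ])
  ^[]-cong op-cong zero    f≈g = f≈g
  ^[]-cong op-cong (suc j) f≈g = op-cong (^[]-cong op-cong j f≈g)

  shift-cong : Congruent shift
  shift-cong f≈g zero    = refl
  shift-cong f≈g (suc n) = f≈g n

  Δ-cong : Congruent Δ
  Δ-cong f≈g n = cong₂ _-_ (f≈g n) (shift-cong f≈g n)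

  ·ₛ-cong : ∀ c → Congruent (c ·ₛ_)
  ·ₛ-cong c f≈g n = cong (c *_) (f≈g n)

  +ₛ-cong : ∀ {f f′ g g′} → f ≈ₛ f′ → g ≈ₛ g′ → (f +ₛ g) ≈ₛ (f′ +ₛ g′)
  +ₛ-cong f≈f′ g≈g′ n = cong₂ _+_ (f≈f′ n) (g≈g′ n)

  shift-Δ : ∀ f → shift (Δ f) ≈ₛ Δ (shift f)
  shift-Δ f zero    = refl
  shift-Δ f (suc n) = refl

  shift-Δ^ : ∀ j f → shift ((Δ ^[ j ]) f) ≈ₛ (Δ ^[ j ]) (shift f)
  shift-Δ^ zero    f = ≈ₛ-refl
  shift-Δ^ (suc j) f = ≈ₛ-trans (shift-Δ ((Δ ^[ j ]) f)) (Δ-cong (shift-Δ^ j f))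

  shift-· : ∀ c f → shift (c ·ₛ f) ≈ₛ (c ·ₛ shift f)
  shift-· c f zero    = sym (ℤP.*-zeroʳ c)
  shift-· c f (suc n) = refl

  Δ-· : ∀ c f → Δ (c ·ₛ f) ≈ₛ (c ·ₛ Δ f)
  Δ-· c f n = trans (cong (c * f n -_) (shift-· c f n)) (sym (*-distribˡ-- c (f n) (shift f n)))

  sumₛ-coeff : ∀ N (F : ℕ → FPS) n → sumₛ N F n ≡ sumℤ N (λ t → F t n)
  sumₛ-coeff zero    F zero    = refl
  sumₛ-coeff zero    F (suc n) = refl
  sumₛ-coeff (suc N) F n       = cong (_+ F N n) (sumₛ-coeff N F n)

  sumₛ-cong : ∀ N {F G : ℕ → FPS} → (∀ t → t < N → F t ≈ₛ G t) → sumₛ N F ≈ₛ sumₛ N G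
  sumₛ-cong N {F} {G} F≈G n = begin
    sumₛ N F n            ≡⟨ sumₛ-coeff N F n ⟩
    sumℤ N (λ t → F t n)  ≡⟨ sumℤ-cong N (λ t t<N → F≈G t t<N n) ⟩
    sumℤ N (λ t → G t n)  ≡⟨ sumₛ-coeff N G n ⟨
    sumₛ N G n            ∎
    where open ≡-Reasoning

  shift-sumₛ : ∀ N (F : ℕ → FPS) → shift (sumₛ N F) ≈ₛ sumₛ N (shift ∘ F)
  shift-sumₛ N F zero    = sym (trans (sumₛ-coeff N (shift ∘ F) zero) (sumℤ-zero N))
  shift-sumₛ N F (suc n) = trans (sumₛ-coeff N F n) (sym (sumₛ-coeff N (shift ∘ F) (suc n)))

  Δ-sumₛ : ∀ N (F : ℕ → FPS) → Δ (sumₛ N F) ≈ₛ sumₛ N (Δ ∘ F)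
  Δ-sumₛ N F n = begin
    sumₛ N F n - shift (sumₛ N F) n
      ≡⟨ cong₂ _-_ (sumₛ-coeff N F n) (trans (shift-sumₛ N F n) (sumₛ-coeff N (shift ∘ F) n)) ⟩
    sumℤ N (λ t → F t n) - sumℤ N (λ t → shift (F t) n)
      ≡⟨ sumℤ-- N (λ t → F t n) (λ t → shift (F t) n) ⟨
    sumℤ N (λ t → Δ (F t) n)
      ≡⟨ sumₛ-coeff N (Δ ∘ F) n ⟨
    sumₛ N (Δ ∘ F) n ∎
    where open ≡-Reasoning

  sumₛ²-coeff : ∀ N (M : ℕ → ℕ) (F : ℕ → ℕ → FPS) n →
    sumₛ N (λ t → sumₛ (M t) (F t)) n ≡ sumℤ N (λ t → sumℤ (M t) (λ u → F t u n))
  sumₛ²-coeff N M F n = trans (sumₛ-coeff N _ n) (sumℤ-cong N (λ t _ → sumₛ-coeff (M t) (F t) n))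

  sumₛ-triangle : ∀ k (T : ℕ → ℕ → FPS) →
    sumₛ k (λ t → sumₛ (suc t) (T t)) ≈ₛ sumₛ k (λ d → sumₛ (k ∸ d) (λ u → T (d ℕ.+ u) d))
  sumₛ-triangle k T n = begin
    sumₛ k (λ t → sumₛ (suc t) (T t)) n
      ≡⟨ sumₛ²-coeff k suc T n ⟩
    sumℤ k (λ t → sumℤ (suc t) (λ j → T t j n))
      ≡⟨ sumℤ-triangle k (λ t j → T t j n) ⟩
    sumℤ k (λ d → sumℤ (k ∸ d) (λ u → T (d ℕ.+ u) d n))
      ≡⟨ sumₛ²-coeff k (k ∸_) (λ d u → T (d ℕ.+ u) d) n ⟨
    sumₛ k (λ d → sumₛ (k ∸ d) (λ u → T (d ℕ.+ u) d)) n ∎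
    where open ≡-Reasoning

  *ₛ-cong : ∀ {f f′ g g′} → f ≈ₛ f′ → g ≈ₛ g′ → (f *ₛ g) ≈ₛ (f′ *ₛ g′)
  *ₛ-cong f≈f′ g≈g′ n = sumℤ-cong (suc n) (λ m _ → cong₂ _*_ (f≈f′ m) (g≈g′ (n ∸ m)))

  *ₛ-identityˡ : ∀ f → (1ₛ *ₛ f) ≈ₛ f
  *ₛ-identityˡ f n = begin
    sumℤ (suc n) (λ m → 1ₛ m * f (n ∸ m))
      ≡⟨ sumℤ-first n (λ m → 1ₛ m * f (n ∸ m)) ⟩
    + 1 * f n + sumℤ n (λ m → 0ℤ * f (n ∸ suc m))
      ≡⟨ cong₂ _+_ (ℤP.*-identityˡ (f n))
                   (trans (sumℤ-cong n (λ m _ → ℤP.*-zeroˡ (f (n ∸ suc m)))) (sumℤ-zero n)) ⟩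
    f n + 0ℤ
      ≡⟨ ℤP.+-identityʳ (f n) ⟩
    f n ∎
    where open ≡-Reasoning

  *ₛ-constʳ : ∀ c f → (f *ₛ const c) ≈ₛ (c ·ₛ f)
  *ₛ-constʳ c f n = begin
    sumℤ n (λ m → f m * const c (n ∸ m)) + f n * const c (n ∸ n)
      ≡⟨ cong₂ _+_ (sumℤ-cong n (λ m m<n → cong (f m *_) (const-positive (ℕP.m<n⇒0<n∸m m<n))))
                   (cong (λ i → f n * const c i) (ℕP.n∸n≡0 n)) ⟩
    sumℤ n (λ m → f m * 0ℤ) + f n * c
      ≡⟨ cong₂ _+_ (trans (sumℤ-cong n (λ m _ → ℤP.*-zeroʳ (f m))) (sumℤ-zero n)) (ℤP.*-comm (f n) c) ⟩
    0ℤ + c * f n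
      ≡⟨ ℤP.+-identityˡ (c * f n) ⟩
    c * f n ∎
    where
    open ≡-Reasoning
    const-positive : ∀ {i} → 0 < i → const c i ≡ 0ℤ
    const-positive {suc i} _ = refl

  *ₛ-shiftˡ : ∀ f g → (shift f *ₛ g) ≈ₛ shift (f *ₛ g)
  *ₛ-shiftˡ f g zero    = ℤP.*-zeroˡ (g 0)
  *ₛ-shiftˡ f g (suc n) = begin
    sumℤ (suc (suc n)) (λ m → shift f m * g (suc n ∸ m))
      ≡⟨ sumℤ-first (suc n) (λ m → shift f m * g (suc n ∸ m)) ⟩
    0ℤ * g (suc n) + (f *ₛ g) n
      ≡⟨ cong (_+ (f *ₛ g) n) (ℤP.*-zeroˡ (g (suc n))) ⟩
    0ℤ + (f *ₛ g) n
      ≡⟨ ℤP.+-identityˡ ((f *ₛ g) n) ⟩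
    (f *ₛ g) n ∎
    where open ≡-Reasoning

  *ₛ-shiftʳ : ∀ f g → (f *ₛ shift g) ≈ₛ shift (f *ₛ g)
  *ₛ-shiftʳ f g zero    = trans (ℤP.+-identityˡ (f 0 * 0ℤ)) (ℤP.*-zeroʳ (f 0))
  *ₛ-shiftʳ f g (suc n) = begin
    sumℤ (suc n) (λ m → f m * shift g (suc n ∸ m)) + f (suc n) * shift g (n ∸ n)
      ≡⟨ cong₂ _+_ (sumℤ-cong (suc n) λ m m<1+n →
                      cong (λ i → f m * shift g i) (ℕP.+-∸-assoc 1 (ℕP.≤-pred m<1+n)))
                   (cong (λ i → f (suc n) * shift g i) (ℕP.n∸n≡0 n)) ⟩
    (f *ₛ g) n + f (suc n) * 0ℤ
      ≡⟨ cong (_+_ ((f *ₛ g) n)) (ℤP.*-zeroʳ (f (suc n))) ⟩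
    (f *ₛ g) n + 0ℤ
      ≡⟨ ℤP.+-identityʳ ((f *ₛ g) n) ⟩
    (f *ₛ g) n ∎
    where open ≡-Reasoning

  *ₛ-distribˡ-- : ∀ f g h → (f *ₛ (g -ₛ h)) ≈ₛ ((f *ₛ g) -ₛ (f *ₛ h))
  *ₛ-distribˡ-- f g h n =
    trans (sumℤ-cong (suc n) (λ m _ → *-distribˡ-- (f m) (g (n ∸ m)) (h (n ∸ m)))) (sumℤ-- (suc n) _ _)

  *ₛ-distribʳ-- : ∀ f g h → ((g -ₛ h) *ₛ f) ≈ₛ ((g *ₛ f) -ₛ (h *ₛ f))
  *ₛ-distribʳ-- f g h n =
    trans (sumℤ-cong (suc n) (λ m _ → *-distribʳ-- (f (n ∸ m)) (g m) (h m))) (sumℤ-- (suc n) _ _)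
    where
    *-distribʳ-- : ∀ a b c → (b - c) * a ≡ b * a - c * a
    *-distribʳ-- = solve-∀

  *ₛ-·ʳ : ∀ c f g → (f *ₛ (c ·ₛ g)) ≈ₛ (c ·ₛ (f *ₛ g))
  *ₛ-·ʳ c f g n =
    trans (sumℤ-cong (suc n) (λ m _ → x*[c*y]≡c*[x*y] c (f m) (g (n ∸ m)))) (sumℤ-*ˡ (suc n) c _)
    where
    x*[c*y]≡c*[x*y] : ∀ c x y → x * (c * y) ≡ c * (x * y)
    x*[c*y]≡c*[x*y] = solve-∀

  *ₛ-sumₛʳ : ∀ f N (G : ℕ → FPS) → (f *ₛ sumₛ N G) ≈ₛ sumₛ N (λ t → f *ₛ G t)
  *ₛ-sumₛʳ f N G n = begin
    sumℤ (suc n) (λ m → f m * sumₛ N G (n ∸ m))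
      ≡⟨ sumℤ-cong (suc n) (λ m _ → cong (f m *_) (sumₛ-coeff N G (n ∸ m))) ⟩
    sumℤ (suc n) (λ m → f m * sumℤ N (λ t → G t (n ∸ m)))
      ≡⟨ sumℤ-cong (suc n) (λ m _ → sumℤ-*ˡ N (f m) (λ t → G t (n ∸ m))) ⟨
    sumℤ (suc n) (λ m → sumℤ N (λ t → f m * G t (n ∸ m)))
      ≡⟨ sumℤ-swap (suc n) N (λ m t → f m * G t (n ∸ m)) ⟩
    sumℤ N (λ t → (f *ₛ G t) n)
      ≡⟨ sumₛ-coeff N (λ t → f *ₛ G t) n ⟨
    sumₛ N (λ t → f *ₛ G t) n ∎
    where open ≡-Reasoning

  X≈shift-1ₛ : X ≈ₛ shift 1ₛ
  X≈shift-1ₛ zero          = refl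
  X≈shift-1ₛ (suc zero)    = refl
  X≈shift-1ₛ (suc (suc n)) = refl

  *ₛ-Xˡ : ∀ f → (X *ₛ f) ≈ₛ shift f
  *ₛ-Xˡ f = ≈ₛ-trans (*ₛ-cong X≈shift-1ₛ (≈ₛ-refl {f}))
                     (≈ₛ-trans (*ₛ-shiftˡ 1ₛ f) (shift-cong (*ₛ-identityˡ f)))

  *ₛ-X^ˡ : ∀ j f → ((X ^ₛ j) *ₛ f) ≈ₛ (shift ^[ j ]) f
  *ₛ-X^ˡ j f = ≈ₛ-trans (*ₛ-cong (X^≈shift^ j) (≈ₛ-refl {f})) (shift^-*ₛ j)
    where
    X^≈shift^ : ∀ j → (X ^ₛ j) ≈ₛ (shift ^[ j ]) 1ₛ
    X^≈shift^ zero    = ≈ₛ-refl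
    X^≈shift^ (suc j) = ≈ₛ-trans (*ₛ-Xˡ (X ^ₛ j)) (shift-cong (X^≈shift^ j))
    shift^-*ₛ : ∀ j → ((shift ^[ j ]) 1ₛ *ₛ f) ≈ₛ (shift ^[ j ]) f
    shift^-*ₛ zero    = *ₛ-identityˡ f
    shift^-*ₛ (suc j) = ≈ₛ-trans (*ₛ-shiftˡ ((shift ^[ j ]) 1ₛ) f) (shift-cong (shift^-*ₛ j))

  *ₛ-[1-X]ˡ : ∀ f → ((1ₛ -ₛ X) *ₛ f) ≈ₛ Δ f
  *ₛ-[1-X]ˡ f n = trans (*ₛ-distribʳ-- f 1ₛ X n) (cong₂ _-_ (*ₛ-identityˡ f n) (*ₛ-Xˡ f n))

  *ₛ-Δʳ : ∀ f g → (f *ₛ Δ g) ≈ₛ Δ (f *ₛ g)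
  *ₛ-Δʳ f g n = trans (*ₛ-distribˡ-- f g (shift g) n) (cong ((f *ₛ g) n -_) (*ₛ-shiftʳ f g n))

  *ₛ-[1-X]^ʳ : ∀ j f → (f *ₛ (1ₛ -ₛ X) ^ₛ j) ≈ₛ (Δ ^[ j ]) f
  *ₛ-[1-X]^ʳ zero    f n = trans (*ₛ-constʳ (+ 1) f n) (ℤP.*-identityˡ (f n))
  *ₛ-[1-X]^ʳ (suc j) f =
    ≈ₛ-trans (*ₛ-cong (≈ₛ-refl {f}) (*ₛ-[1-X]ˡ ((1ₛ -ₛ X) ^ₛ j)))
             (≈ₛ-trans (*ₛ-Δʳ f ((1ₛ -ₛ X) ^ₛ j)) (Δ-cong (*ₛ-[1-X]^ʳ j f)))

  *ₛ-sumₛ-[1-X]^ : ∀ f N (e : ℕ → ℕ) (c : ℕ → ℤ) →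
    (f *ₛ sumₛ N (λ u → (1ₛ -ₛ X) ^ₛ e u *ₛ const (c u))) ≈ₛ sumₛ N (λ u → c u ·ₛ (Δ ^[ e u ]) f)
  *ₛ-sumₛ-[1-X]^ f N e c = ≈ₛ-trans (*ₛ-sumₛʳ f N _) (sumₛ-cong N λ u _ → begin
    f *ₛ ((1ₛ -ₛ X) ^ₛ e u *ₛ const (c u))  ≈⟨ *ₛ-cong (≈ₛ-refl {f}) (*ₛ-constʳ (c u) ((1ₛ -ₛ X) ^ₛ e u)) ⟩
    f *ₛ (c u ·ₛ (1ₛ -ₛ X) ^ₛ e u)          ≈⟨ *ₛ-·ʳ (c u) f ((1ₛ -ₛ X) ^ₛ e u) ⟩
    c u ·ₛ (f *ₛ (1ₛ -ₛ X) ^ₛ e u)          ≈⟨ ·ₛ-cong (c u) (*ₛ-[1-X]^ʳ (e u) f) ⟩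
    c u ·ₛ (Δ ^[ e u ]) f                   ∎)
    where open SetoidReasoning FPS-setoid

  pascal-sum : ∀ r (V : ℕ → ℤ) →
    sumℤ (suc r) (λ j → + (r C j) * V j) + sumℤ (suc r) (λ j → + (r C j) * V (suc j)) ≡
    sumℤ (suc (suc r)) (λ j → + (suc r C j) * V j)
  pascal-sum r V = begin
    sumℤ (suc r) a + sumℤ (suc r) b
      ≡⟨ cong (_+ sumℤ (suc r) b) (sumℤ-first r a) ⟩
    a 0 + sumℤ r (a ∘ suc) + sumℤ (suc r) b
      ≡⟨ cong (λ s → a 0 + s + sumℤ (suc r) b) lastVanishes ⟩
    a 0 + sumℤ (suc r) (a ∘ suc) + sumℤ (suc r) b
      ≡⟨ ℤP.+-assoc (a 0) _ _ ⟩
    a 0 + (sumℤ (suc r) (a ∘ suc) + sumℤ (suc r) b)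
      ≡⟨ cong (_+_ (a 0)) (sumℤ-+ (suc r) (a ∘ suc) b) ⟨
    a 0 + sumℤ (suc r) (λ j → a (suc j) + b j)
      ≡⟨ cong (_+_ (a 0)) (sumℤ-cong (suc r) (λ j _ → pascal j)) ⟩
    a 0 + sumℤ (suc r) (λ j → + (suc r C suc j) * V (suc j))
      ≡⟨ sumℤ-first (suc r) (λ j → + (suc r C j) * V j) ⟨
    sumℤ (suc (suc r)) (λ j → + (suc r C j) * V j) ∎
    where
    open ≡-Reasoning
    a b : ℕ → ℤ
    a j = + (r C j) * V j
    b j = + (r C j) * V (suc j)
    lastVanishes : sumℤ r (a ∘ suc) ≡ sumℤ (suc r) (a ∘ suc)
    lastVanishes = sym (trans (cong (λ c → sumℤ r (a ∘ suc) + + c * V (suc r)) (k>n⇒nCk≡0 (ℕP.n<1+n r)))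
                              (ℤP.+-identityʳ (sumℤ r (a ∘ suc))))
    pascal : ∀ j → a (suc j) + b j ≡ + (suc r C suc j) * V (suc j)
    pascal j = begin
      + (r C suc j) * V (suc j) + + (r C j) * V (suc j)
        ≡⟨ ℤP.*-distribʳ-+ (V (suc j)) (+ (r C suc j)) (+ (r C j)) ⟨
      (+ (r C suc j) + + (r C j)) * V (suc j)
        ≡⟨ cong (_* V (suc j)) (ℤP.pos-+ (r C suc j) (r C j)) ⟨
      + (r C suc j ℕ.+ r C j) * V (suc j)
        ≡⟨ cong (λ c → + c * V (suc j)) (trans (ℕP.+-comm (r C suc j) (r C j)) (nCk+nC[k+1]≡[n+1]C[k+1] r j)) ⟩
      + (suc r C suc j) * V (suc j) ∎

  -- Σ_{j ≤ r} C(r,j) (1 - x)^{r-j} x^j F(m - j)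
  binomialSum : (ℕ → FPS) → ℕ → ℕ → FPS
  binomialSum F m r = sumₛ (suc r) λ j → + (r C j) ·ₛ (Δ ^[ r ∸ j ]) ((shift ^[ j ]) (F (m ∸ j)))

  shift-binomialSum : ∀ F m r → shift (binomialSum F m r) ≈ₛ
    sumₛ (suc r) λ j → + (r C j) ·ₛ (Δ ^[ r ∸ j ]) ((shift ^[ suc j ]) (F (m ∸ j)))
  shift-binomialSum F m r =
    ≈ₛ-trans (shift-sumₛ (suc r) _) (sumₛ-cong (suc r) λ j _ →
      ≈ₛ-trans (shift-· (+ (r C j)) _) (·ₛ-cong (+ (r C j)) (shift-Δ^ (r ∸ j) _)))

  binomialSum-step : ∀ F m r →
    (Δ (binomialSum F m r) +ₛ shift (binomialSum F (m ∸ 1) r)) ≈ₛ binomialSum F m (suc r)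
  binomialSum-step F m r n = begin
    Δ (binomialSum F m r) n + shift (binomialSum F (m ∸ 1) r) n
      ≡⟨ cong₂ _+_ lowered raised ⟩
    sumℤ (suc r) (λ j → + (r C j) * V j) + sumℤ (suc r) (λ j → + (r C j) * V (suc j))
      ≡⟨ pascal-sum r V ⟩
    sumℤ (suc (suc r)) (λ j → + (suc r C j) * V j)
      ≡⟨ sumₛ-coeff (suc (suc r)) _ n ⟨
    binomialSum F m (suc r) n ∎
    where
    open ≡-Reasoning
    V : ℕ → ℤ
    V j = (Δ ^[ suc r ∸ j ]) ((shift ^[ j ]) (F (m ∸ j))) n
    lowered : Δ (binomialSum F m r) n ≡ sumℤ (suc r) (λ j → + (r C j) * V j)
    lowered = trans (Δ-sumₛ (suc r) _ n) (trans (sumₛ-coeff (suc r) _ n) (sumℤ-cong (suc r) λ j j<1+r →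
      trans (Δ-· (+ (r C j)) _ n)
            (cong (λ e → + (r C j) * (Δ ^[ e ]) ((shift ^[ j ]) (F (m ∸ j))) n)
                  (sym (ℕP.+-∸-assoc 1 (ℕP.≤-pred j<1+r))))))
    raised : shift (binomialSum F (m ∸ 1) r) n ≡ sumℤ (suc r) (λ j → + (r C j) * V (suc j))
    raised = trans (shift-binomialSum F (m ∸ 1) r n) (trans (sumₛ-coeff (suc r) _ n) (sumℤ-cong (suc r) λ j _ →
      cong (λ i → + (r C j) * (Δ ^[ r ∸ j ]) ((shift ^[ suc j ]) (F i)) n) (ℕP.∸-+-assoc m 1 j)))

  binomial-expansion : ∀ (G : ℕ → ℕ → FPS) →
    (∀ m r → r < m → G m (suc r) ≈ₛ (Δ (G m r) +ₛ shift (G (m ∸ 1) r))) →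
    ∀ m r → r ≤ m → G m r ≈ₛ binomialSum (λ m′ → G m′ 0) m r
  binomial-expansion G recurrence m zero    _   n =
    sym (trans (sumₛ-coeff 1 (λ _ → + 1 ·ₛ G m 0) n) (trans (ℤP.+-identityˡ _) (ℤP.*-identityˡ (G m 0 n))))
  binomial-expansion G recurrence m (suc r) r<m =
    ≈ₛ-trans (recurrence m r r<m)
    (≈ₛ-trans (+ₛ-cong (Δ-cong (binomial-expansion G recurrence m r (ℕP.<⇒≤ r<m)))
                       (shift-cong (binomial-expansion G recurrence (m ∸ 1) r (ℕP.<⇒≤pred r<m))))
              (binomialSum-step (λ m′ → G m′ 0) m r))

  Accepted : ℕ → ℕ → FPS
  Accepted m r n = + accepted m r n

  Accepted-recurrence : ∀ m r → r < m →
    Accepted m (suc r) ≈ₛ (Δ (Accepted m r) +ₛ shift (Accepted (m ∸ 1) r))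
  Accepted-recurrence m r r<m zero    = refl
  Accepted-recurrence m r r<m (suc n) = begin
    + a′                ≡⟨ x≡x+y-y (+ a′) (+ b) ⟩
    + a′ + + b - + b    ≡⟨ cong (_- + b) (ℤP.pos-+ a′ b) ⟨
    + (a′ ℕ.+ b) - + b  ≡⟨ cong (λ s → + s - + b) (accepted-recurrence m r n r<m) ⟩
    + (a ℕ.+ c) - + b   ≡⟨ cong (_- + b) (ℤP.pos-+ a c) ⟩
    + a + + c - + b     ≡⟨ x+y-z≡x-z+y (+ a) (+ c) (+ b) ⟩
    + a - + b + + c     ∎
    where
    open ≡-Reasoning
    a′ = accepted m (suc r) (suc n)
    a  = accepted m r (suc n)
    b  = accepted m r n
    c  = accepted (m ∸ 1) r n
    x≡x+y-y : ∀ x y → x ≡ x + y - y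
    x≡x+y-y = solve-∀
    x+y-z≡x-z+y : ∀ x y z → x + y - z ≡ x - z + y
    x+y-z≡x-z+y = solve-∀

  F21-1≈Accepted : ∀ k → F21-1 k ≈ₛ Accepted k 0
  F21-1≈Accepted k n = cong +_ (count21-1≡accepted k n)

  F21-1-by-first-letter : ∀ k → F21-1 k ≈ₛ (1ₛ +ₛ shift (sumₛ k (Accepted k)))
  F21-1-by-first-letter k zero    = F21-1≈Accepted k zero
  F21-1-by-first-letter k (suc n) = begin
    F21-1 k (suc n)                   ≡⟨ F21-1≈Accepted k (suc n) ⟩
    + sumℕ k (λ s → accepted k s n)   ≡⟨ +-sumℕ k (λ s → accepted k s n) ⟩
    sumℤ k (λ s → Accepted k s n)     ≡⟨ sumₛ-coeff k (Accepted k) n ⟨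
    sumₛ k (Accepted k) n             ≡⟨ ℤP.+-identityˡ _ ⟨
    + 0 + sumₛ k (Accepted k) n       ∎
    where open ≡-Reasoning

  RHS-summand : ∀ k d →
    ((X ^ₛ suc d) *ₛ F21-1 (k ∸ d) *ₛ sumRangeₛ d k (λ i → ((1ₛ -ₛ X) ^ₛ (i ∸ d)) *ₛ const (+ (i C d))))
    ≈ₛ sumₛ (k ∸ d) (λ u → + ((d ℕ.+ u) C d) ·ₛ (Δ ^[ d ℕ.+ u ∸ d ]) ((shift ^[ suc d ]) (Accepted (k ∸ d) 0)))
  RHS-summand k d =
    ≈ₛ-trans (*ₛ-sumₛ-[1-X]^ ((X ^ₛ suc d) *ₛ F21-1 (k ∸ d)) (k ∸ d) (λ u → d ℕ.+ u ∸ d) (λ u → + ((d ℕ.+ u) C d)))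
             (sumₛ-cong (k ∸ d) λ u _ → ·ₛ-cong (+ ((d ℕ.+ u) C d)) (^[]-cong Δ-cong (d ℕ.+ u ∸ d) X^F≈))
    where
    X^F≈ : ((X ^ₛ suc d) *ₛ F21-1 (k ∸ d)) ≈ₛ (shift ^[ suc d ]) (Accepted (k ∸ d) 0)
    X^F≈ = ≈ₛ-trans (*ₛ-X^ˡ (suc d) (F21-1 (k ∸ d))) (^[]-cong shift-cong (suc d) (F21-1≈Accepted (k ∸ d)))

  F21-1≈RHS : ∀ k → F21-1 k ≈ₛ RHS k
  F21-1≈RHS k = begin
    F21-1 k
      ≈⟨ F21-1-by-first-letter k ⟩
    1ₛ +ₛ shift (sumₛ k (Accepted k))
      ≈⟨ +ₛ-cong (≈ₛ-refl {1ₛ}) (shift-sumₛ k (Accepted k)) ⟩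
    1ₛ +ₛ sumₛ k (shift ∘ Accepted k)
      ≈⟨ +ₛ-cong (≈ₛ-refl {1ₛ}) (sumₛ-cong k λ t t<k → ≈ₛ-trans
           (shift-cong (binomial-expansion Accepted Accepted-recurrence k t (ℕP.<⇒≤ t<k)))
           (shift-binomialSum (λ m → Accepted m 0) k t)) ⟩
    1ₛ +ₛ sumₛ k (λ t → sumₛ (suc t) (term t))
      ≈⟨ +ₛ-cong (≈ₛ-refl {1ₛ}) (sumₛ-triangle k term) ⟩
    1ₛ +ₛ sumₛ k (λ d → sumₛ (k ∸ d) (λ u → term (d ℕ.+ u) d))
      ≈⟨ +ₛ-cong (≈ₛ-refl {1ₛ}) (sumₛ-cong k λ d _ → RHS-summand k d) ⟨
    RHS k ∎
    where
    open SetoidReasoning FPS-setoid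
    term : ℕ → ℕ → FPS
    term t j = + (t C j) ·ₛ (Δ ^[ t ∸ j ]) ((shift ^[ suc j ]) (Accepted (k ∸ j) 0))

open Enumeration using (count21-1≡accepted; count21-2≡accepted)
open GeneratingFunction using (F21-1≈RHS)

theorem3p4 : ((k n : ℕ) → count21-1 k n ≡ count21-2 k n)
           × ((k : ℕ) → F21-2 k ≈ₛ F21-1 k)
           × ((k : ℕ) → F21-1 k ≈ₛ RHS k)
theorem3p4 = count21-1≡count21-2 , (λ k n → cong ℤ.+_ (sym (count21-1≡count21-2 k n))) , F21-1≈RHS
  where
  count21-1≡count21-2 : ∀ k n → count21-1 k n ≡ count21-2 k n
  count21-1≡count21-2 k n = trans (count21-1≡accepted k n) (sym (count21-2≡accepted k n))
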